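{- Let $\gamma_{1,2,2} = 6,4,3,5,2,1 \in S_6$. For all $n \ge 3$, $$|S_n(132, 123, \gamma_{1,2,2})| = F_{n+3}+ F_{n+1} - 3n +2,$$ and $$\sum_{n=0}^\infty |S_n(132, 123, \gamma_{1,2,2})| x^n = -4 -2x - x^2 + \frac{6x^3+4x^2-12x+5}{(1-x)^2 (1-x-x^2)}.$$
   Context: $S_n$ is the set of permutations of $\{1,\dots,n\}$ in one-line notation; $\pi$ avoids $\sigma\in S_k$ if no subsequence of $\pi$ of length $k$ has the same relative order as $\sigma$; $S_n(R)$ is the set of $\pi\in S_n$ avoiding every element of $R$, and $S_0(R)$ contains only the empty permutation. $F_n$ denotes the Fibonacci numbers, $F_0=0$, $F_1=1$, $F_n=F_{n-1}+F_{n-2}$. -}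

module Defs where

open import Data.Nat as ℕ using (ℕ; zero; suc; _∸_)
open import Data.Fin using (Fin; toℕ; #_) renaming (_<_ to _<ᶠ_)
open import Data.Vec using (Vec; []; _∷_; lookup)
open import Data.List using (List; []; _∷_; length; upTo; map; foldr)
open import Data.List.Membership.Propositional using (_∈_)
open import Data.List.Relation.Unary.Unique.Propositional using (Unique)
open import Data.Integer as ℤ using (ℤ; +_)
open import Data.Product using (Σ; _×_)
open import Function.Bundles using (_⇔_)
open import Relation.Binary.PropositionalEquality using (_≡_)
open import Relation.Nullary using (¬_)

F : ℕ → ℕ
F zero = zero
F (suc zero) = suc zero
F (suc (suc n)) = F (suc n) ℕ.+ F n

-- A word of length n over {0,…,n-1} in one-line notation
-- (values shifted by -1 relative to the paper's {1,…,n}).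
Word : ℕ → Set
Word n = Vec (Fin n) n

IsPerm : ∀ {n} → Word n → Set
IsPerm {n} π = (i j : Fin n) → lookup π i ≡ lookup π j → i ≡ j

Contains : ∀ {n k} → Word n → Word k → Set
Contains {n} {k} π σ =
  Σ (Fin k → Fin n) λ f →
    ((i j : Fin k) → i <ᶠ j → f i <ᶠ f j) ×
    ((i j : Fin k) → (lookup σ i <ᶠ lookup σ j) ⇔ (lookup π (f i) <ᶠ lookup π (f j)))

Avoids : ∀ {n k} → Word n → Word k → Set
Avoids π σ = ¬ Contains π σ

p132 : Word 3
p132 = # 0 ∷ # 2 ∷ # 1 ∷ []

p123 : Word 3
p123 = # 0 ∷ # 1 ∷ # 2 ∷ []

γ122 : Word 6
γ122 = # 5 ∷ # 3 ∷ # 2 ∷ # 4 ∷ # 1 ∷ # 0 ∷ []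

InAv : (n : ℕ) → Word n → Set
InAv n π = IsPerm π × Avoids π p132 × Avoids π p123 × Avoids π γ122

HasCard : ∀ {n} → (Word n → Set) → ℕ → Set
HasCard {n} P c =
  Σ (List (Word n)) λ L → Unique L × ((π : Word n) → (π ∈ L) ⇔ P π) × (length L ≡ c)

Series : Set
Series = ℕ → ℤ

_⊕_ : Series → Series → Series
(f ⊕ g) n = f n ℤ.+ g n

_⊛_ : Series → Series → Series
(f ⊛ g) n = foldr ℤ._+_ (+ 0) (map (λ k → f k ℤ.* g (n ∸ k)) (upTo (suc n)))

-- polynomial from its coefficient list (constant term first)
poly : List ℤ → Series
poly [] _ = + 0
poly (c ∷ cs) zero = c
poly (c ∷ cs) (suc n) = poly cs n

oneMinusX : Series
oneMinusX = poly (+ 1 ∷ ℤ.-[1+ 0 ] ∷ [])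

oneMinusXMinusX² : Series
oneMinusXMinusX² = poly (+ 1 ∷ ℤ.-[1+ 0 ] ∷ ℤ.-[1+ 0 ] ∷ [])

fourPlus2xPlusX² : Series
fourPlus2xPlusX² = poly (+ 4 ∷ + 2 ∷ + 1 ∷ [])

numerator : Series
numerator = poly (+ 5 ∷ ℤ.-[1+ 11 ] ∷ + 4 ∷ + 6 ∷ [])

genSeries : (ℕ → ℕ) → Series
genSeries a m = + (a m)

{-# OPTIONS --safe #-}
-- Avoiding 132 and 123 forces every entry to be followed by at most one larger entry, so
-- such a permutation is a skew sum of blocks  r, r-1, …, 1, r+1.  An occurrence of a
-- pattern in a skew sum cuts the pattern into a prefix occurring in the upper part and a
-- suffix occurring in the lower part, and a block only contains decreasing runs possibly
-- followed by a new maximum.  Hence γ = 643521 occurs exactly when some block other than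
-- the first has at least three entries and is followed by two more blocks, or by one
-- block with at least three entries.  Reading the blocks from left to right with a
-- five-state automaton enumerates S_n(132, 123, γ) without repetition; the counts h of
-- the state reached after the first block satisfy h (n + 2) = h (n + 1) + h n + 3 for n ≥ 3,
-- which gives the Fibonacci formula, and a n - 3a (n-1) + 2a (n-2) + a (n-3) - a (n-4) = 0
-- for n ≥ 7, which gives the generating function.
module Submission where

open import Defs
open import Data.Nat using (ℕ; _≤_; _+_; _*_)
open import Data.Integer using (+_) renaming (_+_ to _+ℤ_; _-_ to _-ℤ_)
open import Data.Product using (Σ; _×_)
open import Relation.Binary.PropositionalEquality using (_≡_)

open import Data.Nat using (zero; suc; _<_; z≤n; s≤s; _<?_; _∸_; s<s⁻¹)
open import Data.Nat.Properties
  using (<-asym; <-irrefl; ≤-trans; ≤-refl; <-≤-trans; n<1+n; m≤n+m; n≤1+n; ≤-pred; _≟_; ≤∧≢⇒<;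
         ≤⇒≯; <ᵇ⇒<; m<n⇒m<1+n; <⇒≢; <⇒≤; <⇒≱; ≮⇒≥; <-cmp; m<1+n⇒m<n∨m≡n; m≤n⇒∃[o]m+o≡n;
         n≮0; 1+n≰n)
open import Data.Nat.Induction using (<-rec)
import Data.Nat.Solver
open import Data.Integer using (ℤ; -[1+_])
import Data.Integer as ℤ
open import Data.Integer.Properties using (+-inverseʳ; +-identityˡ)
import Data.Integer.Solver
open import Data.Fin using (Fin; toℕ; zero; suc; fromℕ<; punchOut; lift) renaming (_<_ to _<ᶠ_)
open import Data.Fin.Properties
  using (toℕ-injective; toℕ<n; toℕ-fromℕ<; fromℕ<-toℕ; punchIn-punchOut; punchOut-injective;
         injective⇒≤; any?)
import Data.Fin.Properties as Fin
open import Data.Vec using (Vec; []; _∷_; lookup)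
open import Data.List using (List; []; _∷_; _++_; length; take; drop; map; filter; upTo; foldr; tabulate)
open import Data.List.Properties
  using (++-assoc; ∷-injectiveˡ; ∷-injectiveʳ; length-++; length-map; map-applyUpTo; map-cong;
         map-∘; map-id-local)
open import Data.List.Relation.Unary.All as All using (All; []; _∷_; all?)
open import Data.List.Relation.Unary.All.Properties using (++⁺; ++⁻; map⁺)
open import Data.List.Relation.Unary.Any using (Any; here; there)
open import Data.List.Relation.Unary.AllPairs using ([]; _∷_)
open import Data.List.Relation.Unary.Unique.Propositional using (Unique)
import Data.List.Relation.Unary.Unique.Propositional.Properties as Unique
open import Data.List.Membership.Propositional using (_∈_; lose)
open import Data.List.Membership.Propositional.Properties
  using (∈-filter⁺; ∈-upTo⁺; ∈-++⁻; ∈-++⁺ˡ; ∈-++⁺ʳ; ∈-∃++; ∈-map⁺; ∈-map⁻; ∈-tabulate⁺; ∈-tabulate⁻)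
open import Data.Product using (_,_; proj₁; proj₂; Σ-syntax)
open import Data.Sum using (_⊎_; inj₁; inj₂; [_,_])
open import Data.Unit using (⊤; tt)
open import Data.Empty using (⊥; ⊥-elim)
open import Function using (_∘_)
open import Function.Bundles using (_⇔_; mk⇔; Equivalence)
import Function.Properties.Equivalence as ⇔
open import Relation.Binary using (tri<; tri≈; tri>)
open import Relation.Binary.PropositionalEquality
  using (refl; sym; trans; cong; cong₂; subst; subst₂; _≢_; module ≡-Reasoning)
open import Relation.Nullary using (¬_; Dec; yes; no)
open import Relation.Nullary.Decidable using (_×-dec_; _⊎-dec_; True; toWitness)

open Equivalence using (to; from)

Agree : ℕ × ℕ → ℕ × ℕ → Set
Agree (y₀ , x₀) (y , x) = (y₀ < y ⇔ x₀ < x) × (y < y₀ ⇔ x < x₀)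

agree-< : ∀ {c y x} → proj₁ c < y → proj₂ c < x → Agree c (y , x)
agree-< y₀<y x₀<x =
  mk⇔ (λ _ → x₀<x) (λ _ → y₀<y) ,
  mk⇔ (λ y<y₀ → ⊥-elim (<-asym y<y₀ y₀<y)) (λ x<x₀ → ⊥-elim (<-asym x<x₀ x₀<x))

agree-> : ∀ {c y x} → y < proj₁ c → x < proj₂ c → Agree c (y , x)
agree-> y<y₀ x<x₀ =
  mk⇔ (λ y₀<y → ⊥-elim (<-asym y<y₀ y₀<y)) (λ x₀<x → ⊥-elim (<-asym x<x₀ x₀<x)) ,
  mk⇔ (λ _ → x<x₀) (λ _ → y<y₀)

Compatible : List (ℕ × ℕ) → ℕ × ℕ → Set
Compatible ctx p = All (λ c → Agree c p) ctx

-- Occurs ctx σ τ: σ embeds order-isomorphically into a subsequence of τ,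
-- consistently with the pairs (pattern value , text value) already matched in ctx.
Occurs : List (ℕ × ℕ) → List ℕ → List ℕ → Set
Occurs ctx []      τ       = ⊤
Occurs ctx (y ∷ σ) []      = ⊥
Occurs ctx (y ∷ σ) (x ∷ τ) =
  Occurs ctx (y ∷ σ) τ ⊎ (Compatible ctx (y , x) × Occurs ((y , x) ∷ ctx) σ τ)

infix 4 _≼_

_≼_ : List ℕ → List ℕ → Set
σ ≼ τ = Occurs [] σ τ

occurs-skip : ∀ {ctx} σ us {τ} → Occurs ctx σ τ → Occurs ctx σ (us ++ τ)
occurs-skip []      us       o = tt
occurs-skip (y ∷ σ) []       o = o
occurs-skip (y ∷ σ) (u ∷ us) o = inj₁ (occurs-skip (y ∷ σ) us o)

occurs-pick : ∀ {ctx y x σ} us {τ} →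
              Compatible ctx (y , x) → Occurs ((y , x) ∷ ctx) σ τ → Occurs ctx (y ∷ σ) (us ++ x ∷ τ)
occurs-pick []       ok o = inj₂ (ok , o)
occurs-pick (u ∷ us) ok o = inj₁ (occurs-pick us ok o)

occurs⇒length≤ : ∀ {ctx} σ τ → Occurs ctx σ τ → length σ ≤ length τ
occurs⇒length≤ []      τ       o              = z≤n
occurs⇒length≤ (y ∷ σ) (x ∷ τ) (inj₁ o)       = ≤-trans (occurs⇒length≤ (y ∷ σ) τ o) (n≤1+n _)
occurs⇒length≤ (y ∷ σ) (x ∷ τ) (inj₂ (_ , o)) = s≤s (occurs⇒length≤ σ τ o)

PermutationOf : ℕ → List ℕ → Set
PermutationOf n xs = Unique xs × (∀ v → v ∈ xs ⇔ v < n)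

values : ∀ {m n} → Vec (Fin m) n → List ℕ
values π = tabulate (λ i → toℕ (lookup π i))

Embedding : ∀ {k n} → List (ℕ × ℕ) → (Fin k → ℕ) → (Fin n → ℕ) → Set
Embedding {k} {n} ctx s v =
  Σ[ f ∈ (Fin k → Fin n) ] (∀ i j → i <ᶠ j → f i <ᶠ f j) × (∀ i j → (s i < s j) ⇔ (v (f i) < v (f j))) ×
                           (∀ i → Compatible ctx (s i , v (f i)))

embedding-tail : ∀ {k n ctx s} (v : Fin (suc n) → ℕ) → ((f , _) : Embedding {k} ctx s v) →
                 (∀ i → zero ≢ f i) → Embedding ctx s (v ∘ suc)
embedding-tail {ctx = ctx} {s} v (f , inc , iso , ok) f≢0 =
  f′ , (λ i j i<j → s<s⁻¹ (subst₂ _<ᶠ_ (sym (f≡ i)) (sym (f≡ j)) (inc i j i<j))) ,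
  (λ i j → subst₂ (λ a b → (s i < s j) ⇔ (v a < v b)) (sym (f≡ i)) (sym (f≡ j)) (iso i j)) ,
  (λ i → subst (λ a → Compatible ctx (s i , v a)) (sym (f≡ i)) (ok i))
  where
  f′ = λ i → punchOut (f≢0 i)
  f≡ : ∀ i → suc (f′ i) ≡ f i
  f≡ i = punchIn-punchOut (f≢0 i)

later≢zero : ∀ {n} {a b : Fin (suc n)} → a <ᶠ b → zero ≢ b
later≢zero a<0 refl = n≮0 a<0

embedding⇒occurs : ∀ {k n} ctx (s : Fin k → ℕ) (v : Fin n → ℕ) →
                   Embedding ctx s v → Occurs ctx (tabulate s) (tabulate v)
embedding⇒occurs {zero}          ctx s v _ = tt
embedding⇒occurs {suc k} {zero}  ctx s v (f , _) with () ← f zero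
embedding⇒occurs {suc k} {suc n} ctx s v e@(f , inc , iso , ok) with f zero in f₀≡
... | suc _ = inj₁ (embedding⇒occurs ctx s (v ∘ suc) (embedding-tail v e f≢0))
  where
  f≢0 : ∀ i → zero ≢ f i
  f≢0 zero    0≡f₀ with () ← trans 0≡f₀ f₀≡
  f≢0 (suc i) = later≢zero (inc zero (suc i) (s≤s z≤n))
... | zero  = inj₂ (subst (λ a → Compatible ctx (s zero , v a)) f₀≡ (ok zero) ,
                    embedding⇒occurs _ (s ∘ suc) (v ∘ suc)
                      (embedding-tail v e′ (λ i → later≢zero (inc zero (suc i) (s≤s z≤n)))))
  where
  e′ : Embedding ((s zero , v zero) ∷ ctx) (s ∘ suc) v
  e′ = f ∘ suc , (λ i j i<j → inc (suc i) (suc j) (s≤s i<j)) , (λ i j → iso (suc i) (suc j)) ,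
       λ i → subst (λ a → Agree (s zero , v a) (s (suc i) , v (f (suc i)))) f₀≡ (iso zero (suc i) , iso (suc i) zero) ∷
             ok (suc i)

occurs⇒embedding : ∀ {k n} ctx (s : Fin k → ℕ) (v : Fin n → ℕ) →
                   Occurs ctx (tabulate s) (tabulate v) → Embedding ctx s v
occurs⇒embedding {zero}          ctx s v _ = (λ ()) , (λ ()) , (λ ()) , (λ ())
occurs⇒embedding {suc k} {suc n} ctx s v (inj₁ o) =
  let (f , inc , iso , ok) = occurs⇒embedding ctx s (v ∘ suc) o
  in suc ∘ f , (λ i j i<j → s≤s (inc i j i<j)) , iso , ok
occurs⇒embedding {suc k} {suc n} ctx s v (inj₂ (ok₀ , o))
  with f , inc , iso , ok ← occurs⇒embedding _ (s ∘ suc) (v ∘ suc) o =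
  lift 1 f , increasing , iso′ , ok′
  where
  increasing : ∀ i j → i <ᶠ j → lift 1 f i <ᶠ lift 1 f j
  increasing zero    (suc j) _         = s≤s z≤n
  increasing (suc i) (suc j) (s≤s i<j) = s≤s (inc i j i<j)
  iso′ : ∀ i j → (s i < s j) ⇔ (v (lift 1 f i) < v (lift 1 f j))
  iso′ zero    zero    = mk⇔ (⊥-elim ∘ <-irrefl refl) (⊥-elim ∘ <-irrefl refl)
  iso′ zero    (suc j) = proj₁ (All.head (ok j))
  iso′ (suc i) zero    = proj₂ (All.head (ok i))
  iso′ (suc i) (suc j) = iso i j
  ok′ : ∀ i → Compatible ctx (s i , v (lift 1 f i))
  ok′ zero    = ok₀
  ok′ (suc i) = All.tail (ok i)

contains⇔occurs : ∀ {n k} (π : Word n) (σ : Word k) → Contains π σ ⇔ values σ ≼ values π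
contains⇔occurs π σ = mk⇔
  (λ (f , inc , iso) → embedding⇒occurs [] _ _ (f , inc , iso , λ _ → []))
  (λ o → let (f , inc , iso , _) = occurs⇒embedding [] _ _ o in f , inc , iso)

tabulate-unique⇒injective : ∀ {n} (g : Fin n → ℕ) → Unique (tabulate g) → ∀ i j → g i ≡ g j → i ≡ j
tabulate-unique⇒injective g u         zero    zero    _ = refl
tabulate-unique⇒injective g (g₀∉ ∷ _) zero    (suc j) e = ⊥-elim (All.lookup g₀∉ (∈-tabulate⁺ j) e)
tabulate-unique⇒injective g (g₀∉ ∷ _) (suc i) zero    e = ⊥-elim (All.lookup g₀∉ (∈-tabulate⁺ i) (sym e))
tabulate-unique⇒injective g (_ ∷ u)   (suc i) (suc j) e = cong suc (tabulate-unique⇒injective (g ∘ suc) u i j e)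

-- by the pigeonhole principle
isPerm⇒covers : ∀ {n} (π : Word n) → IsPerm π → ∀ v → v < n → v ∈ values π
isPerm⇒covers {suc m} π inj v v<n with any? (λ i → lookup π i Fin.≟ fromℕ< v<n)
... | yes (i , πi≡v) =
  subst (_∈ values π) (trans (cong toℕ πi≡v) (toℕ-fromℕ< v<n)) (∈-tabulate⁺ {f = λ i → toℕ (lookup π i)} i)
... | no  missing    = ⊥-elim (1+n≰n (injective⇒≤ punched-injective))
  where
  v≢π : ∀ i → fromℕ< v<n ≢ lookup π i
  v≢π i v≡πi = missing (i , sym v≡πi)
  punched : Fin (suc m) → Fin m
  punched i = punchOut (v≢π i)
  punched-injective : ∀ {i j} → punched i ≡ punched j → i ≡ j
  punched-injective {i} {j} e = inj i j (punchOut-injective (v≢π i) (v≢π j) e)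

isPerm⇔permutationOf : ∀ {n} (π : Word n) → IsPerm π ⇔ PermutationOf n (values π)
isPerm⇔permutationOf {n} π = mk⇔
  (λ inj → Unique.tabulate⁺ (λ e → inj _ _ (toℕ-injective e)) , λ v → mk⇔ (bounded v) (isPerm⇒covers π inj v))
  (λ (u , _) i j πi≡πj → tabulate-unique⇒injective _ u i j (cong toℕ πi≡πj))
  where
  bounded : ∀ v → v ∈ values π → v < n
  bounded v v∈ with i , refl ← ∈-tabulate⁻ {f = λ i → toℕ (lookup π i)} v∈ = toℕ<n (lookup π i)

-- junk value: an entry that is out of range is read as the default d
clamp : ∀ {n} → Fin n → ℕ → Fin n
clamp {n} d v with v <? n
... | yes v<n = fromℕ< v<n
... | no  _   = d

clamp-toℕ : ∀ {n} d (a : Fin n) → clamp d (toℕ a) ≡ a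
clamp-toℕ {n} d a with toℕ a <? n
... | yes a<n = fromℕ<-toℕ a a<n
... | no  a≮n = ⊥-elim (a≮n (toℕ<n a))

toℕ-clamp : ∀ {n} d v → v < n → toℕ (clamp {n} d v) ≡ v
toℕ-clamp {n} d v v<n with v <? n
... | yes v<n′ = toℕ-fromℕ< v<n′
... | no  v≮n  = ⊥-elim (v≮n v<n)

fins : ∀ {n} → Fin n → (k : ℕ) → List ℕ → Vec (Fin n) k
fins d zero    xs       = []
fins d (suc k) []       = d ∷ fins d k []
fins d (suc k) (x ∷ xs) = clamp d x ∷ fins d k xs

toWord : ∀ n → List ℕ → Word n
toWord zero    xs = []
toWord (suc m) xs = fins zero (suc m) xs

values-fins : ∀ {n} (d : Fin n) xs → All (_< n) xs → values (fins d (length xs) xs) ≡ xs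
values-fins d []       []            = refl
values-fins d (x ∷ xs) (x<n ∷ xs<n) = cong₂ _∷_ (toℕ-clamp d x x<n) (values-fins d xs xs<n)

fins-values : ∀ {n k} (d : Fin n) (π : Vec (Fin n) k) → fins d k (values π) ≡ π
fins-values d []      = refl
fins-values d (a ∷ π) = cong₂ _∷_ (clamp-toℕ d a) (fins-values d π)

values-toWord : ∀ n xs → length xs ≡ n → All (_< n) xs → values (toWord n xs) ≡ xs
values-toWord zero    []  _ _    = refl
values-toWord (suc m) xs  e xs<n = subst (λ k → values (fins zero k xs) ≡ xs) e (values-fins zero xs xs<n)

toWord-values : ∀ n (π : Word n) → toWord n (values π) ≡ π
toWord-values zero    [] = refl
toWord-values (suc m) π  = fins-values zero π

Above : List ℕ → List ℕ → Set
Above xs ys = All (λ x → All (_< x) ys) xs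

above? : ∀ xs ys → Dec (Above xs ys)
above? xs ys = all? (λ x → all? (_<? x) ys) xs

TextAbove : List (ℕ × ℕ) → List ℕ → Set
TextAbove ctx ρ = All (λ c → All (_< proj₂ c) ρ) ctx

PatternAbove : List (ℕ × ℕ) → List ℕ → Set
PatternAbove ctx σ = All (λ c → All (_< proj₁ c) σ) ctx

compatible-high⁻ : ∀ {H y x} → All (λ c → x < proj₂ c) H → Compatible H (y , x) → All (λ c → y < proj₁ c) H
compatible-high⁻ x<H ok = All.zipWith (λ (x<c , ag) → from (proj₂ ag) x<c) (x<H , ok)

compatible-high⁺ : ∀ {H y x} → All (λ c → x < proj₂ c) H → All (λ c → y < proj₁ c) H → Compatible H (y , x)
compatible-high⁺ x<H y<H = All.zipWith (λ (x<c , y<c) → agree-> y<c x<c) (x<H , y<H)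

-- Matched pairs lying entirely above the remaining text constrain nothing but
-- the pattern values still to be matched, which must lie below them.
occurs-dropHigh⁻ : ∀ L {H} σ {ρ} → TextAbove H ρ → Occurs (L ++ H) σ ρ → PatternAbove H σ × Occurs L σ ρ
occurs-dropHigh⁻ L      []      hH o = All.universal (λ _ → []) _ , tt
occurs-dropHigh⁻ L      (y ∷ σ) {[]}    hH ()
occurs-dropHigh⁻ L      (y ∷ σ) {r ∷ ρ} hH (inj₁ o) =
  let (a , o′) = occurs-dropHigh⁻ L (y ∷ σ) (All.map All.tail hH) o in a , inj₁ o′
occurs-dropHigh⁻ L {H}  (y ∷ σ) {r ∷ ρ} hH (inj₂ (ok , o)) =
  let (a , o′)    = occurs-dropHigh⁻ ((y , r) ∷ L) σ (All.map All.tail hH) o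
      (okL , okH) = ++⁻ L ok
  in All.zipWith (λ (y<c , a<c) → y<c ∷ a<c) (compatible-high⁻ (All.map All.head hH) okH , a) ,
     inj₂ (okL , o′)

occurs-dropHigh⁺ : ∀ L {H} σ {ρ} → TextAbove H ρ → PatternAbove H σ → Occurs L σ ρ → Occurs (L ++ H) σ ρ
occurs-dropHigh⁺ L []      hH hσ o = tt
occurs-dropHigh⁺ L (y ∷ σ) {[]}    hH hσ ()
occurs-dropHigh⁺ L (y ∷ σ) {r ∷ ρ} hH hσ (inj₁ o) =
  inj₁ (occurs-dropHigh⁺ L (y ∷ σ) (All.map All.tail hH) hσ o)
occurs-dropHigh⁺ L (y ∷ σ) {r ∷ ρ} hH hσ (inj₂ (ok , o)) =
  inj₂ (++⁺ ok (compatible-high⁺ (All.map All.head hH) (All.map All.head hσ)) ,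
        occurs-dropHigh⁺ ((y , r) ∷ L) σ (All.map All.tail hH) (All.map All.tail hσ) o)

SkewSplit : List (ℕ × ℕ) → List ℕ → List ℕ → List ℕ → Set
SkewSplit ctx σ P ρ =
  Σ[ k ∈ ℕ ] k ≤ length σ × Above (take k σ) (drop k σ) × PatternAbove ctx (drop k σ) ×
             Occurs ctx (take k σ) P × drop k σ ≼ ρ

occurs-skew⁻ : ∀ ctx P {ρ} σ → TextAbove ctx ρ → Above P ρ → Occurs ctx σ (P ++ ρ) → SkewSplit ctx σ P ρ
occurs-skew⁻ ctx []      σ       hc hP o =
  let (a , o′) = occurs-dropHigh⁻ [] σ hc o in 0 , z≤n , [] , a , tt , o′
occurs-skew⁻ ctx (p ∷ P) []      hc hP o = 0 , z≤n , [] , All.universal (λ _ → []) ctx , tt , tt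
occurs-skew⁻ ctx (p ∷ P) (y ∷ σ) hc (_ ∷ hP) (inj₁ o) =
  let (k , k≤ , a , pa , o₁ , o₂) = occurs-skew⁻ ctx P (y ∷ σ) hc hP o
  in k , k≤ , a , pa , occurs-skip (take k (y ∷ σ)) (p ∷ []) o₁ , o₂
occurs-skew⁻ ctx (p ∷ P) (y ∷ σ) hc (hp ∷ hP) (inj₂ (ok , o)) =
  let (k , k≤ , a , pa , o₁ , o₂) = occurs-skew⁻ ((y , p) ∷ ctx) P σ (hp ∷ hc) hP o
  in suc k , s≤s k≤ , All.head pa ∷ a , All.tail pa , inj₂ (ok , o₁) , o₂

occurs-skew⁺ : ∀ ctx P {ρ} σ k → TextAbove ctx ρ → Above P ρ →
               Above (take k σ) (drop k σ) → PatternAbove ctx (drop k σ) →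
               Occurs ctx (take k σ) P → drop k σ ≼ ρ → Occurs ctx σ (P ++ ρ)
occurs-skew⁺ ctx []      σ       zero    hc hP a pa o₁ o₂ = occurs-dropHigh⁺ [] σ hc pa o₂
occurs-skew⁺ ctx []      []      (suc k) hc hP a pa o₁ o₂ = tt
occurs-skew⁺ ctx (p ∷ P) []      k       hc hP a pa o₁ o₂ = tt
occurs-skew⁺ ctx (p ∷ P) (y ∷ σ) zero    hc (_ ∷ hP) a pa o₁ o₂ =
  inj₁ (occurs-skew⁺ ctx P (y ∷ σ) zero hc hP a pa tt o₂)
occurs-skew⁺ ctx (p ∷ P) (y ∷ σ) (suc k) hc (_ ∷ hP) a pa (inj₁ o₁) o₂ =
  inj₁ (occurs-skew⁺ ctx P (y ∷ σ) (suc k) hc hP a pa o₁ o₂)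
occurs-skew⁺ ctx (p ∷ P) (y ∷ σ) (suc k) hc (hp ∷ hP) (y> ∷ a) pa (inj₂ (ok , o₁)) o₂ =
  inj₂ (ok , occurs-skew⁺ ((y , p) ∷ ctx) P σ k (hp ∷ hc) hP a (y> ∷ pa) o₁ o₂)

skew-sum⁻ : ∀ {P ρ σ} → Above P ρ → σ ≼ P ++ ρ →
            Σ[ k ∈ ℕ ] k ≤ length σ × Above (take k σ) (drop k σ) × take k σ ≼ P × drop k σ ≼ ρ
skew-sum⁻ {P} {σ = σ} hP o =
  let (k , k≤ , a , _ , o₁ , o₂) = occurs-skew⁻ [] P σ [] hP o in k , k≤ , a , o₁ , o₂

skew-sum⁺ : ∀ {P ρ} σ k → Above P ρ → Above (take k σ) (drop k σ) → take k σ ≼ P → drop k σ ≼ ρ → σ ≼ P ++ ρ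
skew-sum⁺ {P} σ k hP a = occurs-skew⁺ [] P σ k [] hP a []

run : ℕ → ℕ → List ℕ
run zero    b = []
run (suc r) b = r + b ∷ run r b

-- block r b is the pattern  r, r-1, …, 1, r+1  (in the paper's 1-based values), shifted up by b
block : ℕ → ℕ → List ℕ
block r b = run r b ++ r + b ∷ []

-- BlockShaped ys σ: σ continues the pattern values ys (most recent first) as a decreasing run,
-- whose last entry may instead be a new maximum.
BlockShaped : List ℕ → List ℕ → Set
BlockShaped ys []          = ⊤
BlockShaped ys (y ∷ [])    = All (_< y) ys ⊎ All (y <_) ys
BlockShaped ys (y ∷ z ∷ σ) = All (y <_) ys × BlockShaped (y ∷ ys) (z ∷ σ)

blockShaped? : ∀ ys σ → Dec (BlockShaped ys σ)
blockShaped? ys []          = yes tt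
blockShaped? ys (y ∷ [])    = all? (_<? y) ys ⊎-dec all? (y <?_) ys
blockShaped? ys (y ∷ z ∷ σ) = all? (y <?_) ys ×-dec blockShaped? (y ∷ ys) (z ∷ σ)

occurs-run-top⇒blockShaped : ∀ ctx r b t σ → r + b ≤ t → All (λ c → r + b ≤ proj₂ c × proj₂ c < t) ctx →
                             Occurs ctx σ (run r b ++ t ∷ []) → BlockShaped (map proj₁ ctx) σ
occurs-run-top⇒blockShaped ctx r       b t []          _ _ _ = tt
occurs-run-top⇒blockShaped ctx zero    b t (y ∷ [])    _ hc (inj₂ (ok , _)) =
  inj₁ (map⁺ (All.zipWith (λ ((_ , x<t) , ag) → from (proj₁ ag) x<t) (hc , ok)))
occurs-run-top⇒blockShaped ctx (suc r) b t (y ∷ σ)     le hc (inj₁ o) =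
  occurs-run-top⇒blockShaped ctx r b t (y ∷ σ) (≤-trans (n≤1+n _) le)
    (All.map (λ (r+b<x , x<t) → ≤-trans (n≤1+n _) r+b<x , x<t) hc) o
occurs-run-top⇒blockShaped ctx (suc r) b t (y ∷ [])    le hc (inj₂ (ok , _)) =
  inj₂ (map⁺ (compatible-high⁻ (All.map proj₁ hc) ok))
occurs-run-top⇒blockShaped ctx (suc r) b t (y ∷ z ∷ σ) le hc (inj₂ (ok , o)) =
  map⁺ (compatible-high⁻ (All.map proj₁ hc) ok) ,
  occurs-run-top⇒blockShaped ((y , r + b) ∷ ctx) r b t (z ∷ σ) (≤-trans (n≤1+n _) le)
    ((≤-refl , le) ∷ All.map (λ (r+b<x , x<t) → ≤-trans (n≤1+n _) r+b<x , x<t) hc) o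

occurs-block⇒blockShaped : ∀ {r b σ} → σ ≼ block r b → BlockShaped [] σ
occurs-block⇒blockShaped {r} {b} {σ} = occurs-run-top⇒blockShaped [] r b (r + b) σ ≤-refl []

∈-run⁻ : ∀ r b {v} → v ∈ run r b → b ≤ v × v < r + b
∈-run⁻ (suc r) b (here refl) = m≤n+m b r , n<1+n (r + b)
∈-run⁻ (suc r) b (there v∈) = let (b≤v , v<) = ∈-run⁻ r b v∈ in b≤v , m<n⇒m<1+n v<

∈-run⁺ : ∀ r b {v} → b ≤ v → v < r + b → v ∈ run r b
∈-run⁺ zero    b b≤v v<b = ⊥-elim (≤⇒≯ b≤v v<b)
∈-run⁺ (suc r) b {v} b≤v v< with v ≟ r + b
... | yes refl = here refl
... | no  v≢   = there (∈-run⁺ r b b≤v (≤∧≢⇒< (≤-pred v<) v≢))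

∈-block⁻ : ∀ r b {v} → v ∈ block r b → b ≤ v × v ≤ r + b
∈-block⁻ r b v∈ with ∈-++⁻ (run r b) v∈
... | inj₁ v∈run       = let (b≤v , v<) = ∈-run⁻ r b v∈run in b≤v , <⇒≤ v<
... | inj₂ (here refl) = m≤n+m b r , ≤-refl

∈-block⁺ : ∀ r b {v} → b ≤ v → v ≤ r + b → v ∈ block r b
∈-block⁺ r b {v} b≤v v≤ with v ≟ r + b
... | yes refl = ∈-++⁺ʳ (run r b) (here refl)
... | no  v≢   = ∈-++⁺ˡ (∈-run⁺ r b b≤v (≤∧≢⇒< v≤ v≢))

run-unique : ∀ r b → Unique (run r b)
run-unique zero    b = []
run-unique (suc r) b = All.tabulate (λ v∈ → <⇒≢ (proj₂ (∈-run⁻ r b v∈)) ∘ sym) ∷ run-unique r b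

block-unique : ∀ r b → Unique (block r b)
block-unique r b = Unique.++⁺ (run-unique r b) ([] ∷ [])
  λ { (v∈run , here v≡) → <⇒≢ (proj₂ (∈-run⁻ r b v∈run)) v≡ }

above-block : ∀ {r b ρ} → All (_< b) ρ → Above (block r b) ρ
above-block {r} {b} ρ<b =
  All.tabulate (λ v∈ → All.map (λ x<b → <-≤-trans x<b (proj₁ (∈-block⁻ r b v∈))) ρ<b)

singleton-occurs-block : ∀ y r b → y ∷ [] ≼ block r b
singleton-occurs-block y r b = occurs-pick (run r b) [] tt

-- γ = 643521 = 1 ⊖ γ⁻ and γ⁻ = 43521 = 213 ⊖ 21, in the paper's notation
γ : List ℕ
γ = values γ122

γ⁻ : List ℕ
γ⁻ = drop 1 γ

p213 : List ℕ
p213 = take 3 γ⁻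

p21 : List ℕ
p21 = drop 3 γ⁻

p1 : List ℕ
p1 = 0 ∷ []

data Size : Set where
  short long : Size

-- r is the length of the run, so the block has r + 1 entries
size : ℕ → Size
size (suc (suc _)) = long
size _             = short

SizeFacts : Size → List ℕ → Set
SizeFacts short B = ¬ p213 ≼ B × ¬ p21 ≼ B
SizeFacts long  B = p213 ≼ B × p21 ≼ B

block-sizeFacts : ∀ r b → SizeFacts (size r) (block r b)
block-sizeFacts zero b =
  (λ o → ≤⇒≯ (occurs⇒length≤ p213 _ o) (<ᵇ⇒< _ _ tt)) ,
  (λ o → ≤⇒≯ (occurs⇒length≤ p21 _ o) (<ᵇ⇒< _ _ tt))
block-sizeFacts (suc zero) b =
  (λ o → ≤⇒≯ (occurs⇒length≤ p213 _ o) (<ᵇ⇒< _ _ tt)) , no-descent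
  where
  no-descent : ¬ p21 ≼ b ∷ suc b ∷ []
  no-descent (inj₁ o)                = ≤⇒≯ (occurs⇒length≤ p21 _ o) (<ᵇ⇒< _ _ tt)
  no-descent (inj₂ (_ , inj₂ (agree ∷ [] , _))) = <-asym (n<1+n b) (to (proj₂ agree) (<ᵇ⇒< _ _ tt))
block-sizeFacts (suc (suc r)) b =
  inj₂ ([] , inj₂ (agree-> (<ᵇ⇒< _ _ tt) (n<1+n _) ∷ [] ,
                   occurs-pick (run r b) (agree-< (<ᵇ⇒< _ _ tt) (m<n⇒m<1+n (n<1+n _)) ∷
                                          agree-< (<ᵇ⇒< _ _ tt) (n<1+n _) ∷ []) tt)) ,
  inj₂ ([] , inj₂ (agree-> (<ᵇ⇒< _ _ tt) (n<1+n _) ∷ [] , tt))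

BlockSplit : List ℕ → ℕ → Set
BlockSplit σ k = BlockShaped [] (take k σ) × Above (take k σ) (drop k σ)

blockSplit? : ∀ σ k → Dec (BlockSplit σ k)
blockSplit? σ k = blockShaped? [] (take k σ) ×-dec above? (take k σ) (drop k σ)

-- the possible cuts of an occurrence of σ in a block followed by lower entries;
-- for the fixed patterns below, this list is computed by evaluation
blockSplits : List ℕ → List ℕ
blockSplits σ = filter (blockSplit? σ) (upTo (suc (length σ)))

occurs-block-++⁻ : ∀ {r b ρ σ} → All (_< b) ρ → σ ≼ block r b ++ ρ →
                   Any (λ k → take k σ ≼ block r b × drop k σ ≼ ρ) (blockSplits σ)
occurs-block-++⁻ {σ = σ} ρ<b o =
  let (k , k≤ , a , o₁ , o₂) = skew-sum⁻ (above-block ρ<b) o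
  in lose (∈-filter⁺ (blockSplit? σ) (∈-upTo⁺ (s≤s k≤)) (occurs-block⇒blockShaped o₁ , a)) (o₁ , o₂)

AvoidsAll : List (List ℕ) → List ℕ → Set
AvoidsAll ps xs = All (λ σ → ¬ σ ≼ xs) ps

avoids-suffix : ∀ {ps} us {xs} → AvoidsAll ps (us ++ xs) → AvoidsAll ps xs
avoids-suffix us = All.map (_∘ occurs-skip _ us)

p132-p123 : List (List ℕ)
p132-p123 = values p132 ∷ values p123 ∷ []

data State : Set where
  start middle afterLong finished dead : State

-- forbidden q: what the remaining entries must avoid, given the blocks read so far.
-- The first block can play the 6 of γ = 643521, a later long block the 435 and the
-- block after that the 2; dead forbids the empty pattern and so rejects everything.
forbidden : State → List (List ℕ)
forbidden start     = γ ∷ []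
forbidden middle    = γ⁻ ∷ γ ∷ []
forbidden afterLong = p21 ∷ γ⁻ ∷ γ ∷ []
forbidden finished  = p1 ∷ p21 ∷ γ⁻ ∷ γ ∷ []
forbidden dead      = [] ∷ []

next : State → Size → State
next start     _     = middle
next middle    short = middle
next middle    long  = afterLong
next afterLong short = finished
next afterLong long  = dead
next finished  _     = dead
next dead      _     = dead

nothing-avoids-dead : ∀ {xs} → ¬ AvoidsAll (forbidden dead) xs
nothing-avoids-dead (¬[] ∷ []) = ¬[] tt

module BlockAbove {r b : ℕ} {ρ : List ℕ} (ρ<b : All (_< b) ρ) where

  weaken : ∀ {σ} → σ ≼ ρ → σ ≼ block r b ++ ρ
  weaken {σ} = occurs-skip σ (block r b)

  avoids-weaken : ∀ {ps} → AvoidsAll ps (block r b ++ ρ) → AvoidsAll ps ρ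
  avoids-weaken = avoids-suffix (block r b)

  occurs-below : ∀ {σ} → blockSplits σ ≡ 0 ∷ [] → σ ≼ block r b ++ ρ → σ ≼ ρ
  occurs-below {σ} splits o with blockSplits σ | splits | occurs-block-++⁻ ρ<b o
  ... | _ | refl | here (_ , o₂) = o₂

  avoids-p132-p123 : AvoidsAll p132-p123 (block r b ++ ρ) ⇔ AvoidsAll p132-p123 ρ
  avoids-p132-p123 = mk⇔ avoids-weaken
    (λ { (¬p132 ∷ ¬p123 ∷ []) → ¬p132 ∘ occurs-below refl ∷ ¬p123 ∘ occurs-below refl ∷ [] })

  join : ∀ σ k → {True (above? (take k σ) (drop k σ))} →
         take k σ ≼ block r b → drop k σ ≼ ρ → σ ≼ block r b ++ ρ
  join σ k {a} = skew-sum⁺ σ k (above-block ρ<b) (toWitness a)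

  γ-split : γ ≼ block r b ++ ρ → γ ≼ ρ ⊎ γ⁻ ≼ ρ
  γ-split o with occurs-block-++⁻ ρ<b o
  ... | here (_ , o₂)         = inj₁ o₂
  ... | there (here (_ , o₂)) = inj₂ o₂

  γ⁻-split : γ⁻ ≼ block r b ++ ρ → γ⁻ ≼ ρ ⊎ (p213 ≼ block r b × p21 ≼ ρ)
  γ⁻-split o with occurs-block-++⁻ ρ<b o
  ... | here (_ , o₂)         = inj₁ o₂
  ... | there (here (o₁ , o₂)) = inj₂ (o₁ , o₂)

  p21-split : p21 ≼ block r b ++ ρ → p21 ≼ ρ ⊎ p1 ≼ ρ ⊎ p21 ≼ block r b
  p21-split o with occurs-block-++⁻ ρ<b o
  ... | here (_ , o₂)                 = inj₁ o₂
  ... | there (here (_ , o₂))         = inj₂ (inj₁ o₂)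
  ... | there (there (here (o₁ , _))) = inj₂ (inj₂ o₁)

  avoid-γ : ¬ γ⁻ ≼ ρ → ¬ γ ≼ ρ → ¬ γ ≼ block r b ++ ρ
  avoid-γ ¬γ⁻ ¬γ = [ ¬γ , ¬γ⁻ ] ∘ γ-split

  avoid-γ⁻ : ¬ (p213 ≼ block r b × p21 ≼ ρ) → ¬ γ⁻ ≼ ρ → ¬ γ⁻ ≼ block r b ++ ρ
  avoid-γ⁻ ¬both ¬γ⁻ = [ ¬γ⁻ , ¬both ] ∘ γ⁻-split

  avoids-next : ∀ q s → SizeFacts s (block r b) →
                AvoidsAll (forbidden q) (block r b ++ ρ) ⇔ AvoidsAll (forbidden (next q s)) ρ
  avoids-next start s _ = mk⇔
    (λ { av@(¬γ ∷ []) → ¬γ ∘ join γ 1 (singleton-occurs-block _ r b) ∷ avoids-weaken av })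
    (λ { (¬γ⁻ ∷ ¬γ ∷ []) → avoid-γ ¬γ⁻ ¬γ ∷ [] })
  avoids-next middle short (¬p213 , _) = mk⇔
    avoids-weaken
    (λ { (¬γ⁻ ∷ ¬γ ∷ []) → avoid-γ⁻ (¬p213 ∘ proj₁) ¬γ⁻ ∷ avoid-γ ¬γ⁻ ¬γ ∷ [] })
  avoids-next middle long (p213-in-B , _) = mk⇔
    (λ { av@(¬γ⁻ ∷ _) → ¬γ⁻ ∘ join γ⁻ 3 p213-in-B ∷ avoids-weaken av })
    (λ { (¬p21 ∷ ¬γ⁻ ∷ ¬γ ∷ []) → avoid-γ⁻ (¬p21 ∘ proj₂) ¬γ⁻ ∷ avoid-γ ¬γ⁻ ¬γ ∷ [] })
  avoids-next afterLong short (¬p213 , ¬p21-in-B) = mk⇔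
    (λ { av@(¬p21 ∷ _) → ¬p21 ∘ join p21 1 (singleton-occurs-block _ r b) ∷ avoids-weaken av })
    (λ { (¬p1 ∷ ¬p21 ∷ ¬γ⁻ ∷ ¬γ ∷ []) →
           [ ¬p21 , [ ¬p1 , ¬p21-in-B ] ] ∘ p21-split ∷
           avoid-γ⁻ (¬p213 ∘ proj₁) ¬γ⁻ ∷ avoid-γ ¬γ⁻ ¬γ ∷ [] })
  avoids-next afterLong long (_ , p21-in-B) = mk⇔
    (λ { (¬p21 ∷ _) → ⊥-elim (¬p21 (join p21 2 p21-in-B tt)) })
    (⊥-elim ∘ nothing-avoids-dead)
  avoids-next finished s _ = mk⇔
    (λ { (¬p1 ∷ _) → ⊥-elim (¬p1 (join p1 1 (singleton-occurs-block _ r b) tt)) })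
    (⊥-elim ∘ nothing-avoids-dead)
  avoids-next dead s _ = mk⇔ (⊥-elim ∘ nothing-avoids-dead) (⊥-elim ∘ nothing-avoids-dead)

Before : ℕ → ℕ → List ℕ → Set
Before a c ys = Σ[ us ∈ List ℕ ] Σ[ vs ∈ List ℕ ] ys ≡ us ++ a ∷ vs × c ∈ vs

before-or-after : ∀ {a c} ys → a ∈ ys → c ∈ ys → a ≢ c → Before a c ys ⊎ Before c a ys
before-or-after (y ∷ ys) (here refl) (here refl) a≢c = ⊥-elim (a≢c refl)
before-or-after (y ∷ ys) (here refl) (there c∈)  _   = inj₁ ([] , ys , refl , c∈)
before-or-after (y ∷ ys) (there a∈)  (here refl) _   = inj₂ ([] , ys , refl , a∈)
before-or-after (y ∷ ys) (there a∈)  (there c∈)  a≢c with before-or-after ys a∈ c∈ a≢c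
... | inj₁ (us , vs , refl , c∈vs) = inj₁ (y ∷ us , vs , refl , c∈vs)
... | inj₂ (us , vs , refl , a∈vs) = inj₂ (y ∷ us , vs , refl , a∈vs)

larger-pair-after : ∀ {x a c ys} → x < a → x < c → a ≢ c → Before a c ys → ¬ AvoidsAll p132-p123 (x ∷ ys)
larger-pair-after {x} {a} {c} x<a x<c a≢c (us , vs , refl , c∈vs) (¬p132 ∷ ¬p123 ∷ [])
  with ws , zs , refl ← ∈-∃++ c∈vs | <-cmp a c
... | tri< a<c _ _ = ¬p123 (inj₂ ([] , occurs-pick us (agree-< (<ᵇ⇒< _ _ tt) x<a ∷ [])
        (occurs-pick ws (agree-< (<ᵇ⇒< _ _ tt) a<c ∷ agree-< (<ᵇ⇒< _ _ tt) x<c ∷ []) tt)))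
... | tri≈ _ a≡c _ = a≢c a≡c
... | tri> _ _ c<a = ¬p132 (inj₂ ([] , occurs-pick us (agree-< (<ᵇ⇒< _ _ tt) x<a ∷ [])
        (occurs-pick ws (agree-> (<ᵇ⇒< _ _ tt) c<a ∷ agree-< (<ᵇ⇒< _ _ tt) x<c ∷ []) tt)))

two-larger-after : ∀ {x a c ys} → x < a → x < c → a ≢ c → a ∈ ys → c ∈ ys → ¬ AvoidsAll p132-p123 (x ∷ ys)
two-larger-after x<a x<c a≢c a∈ c∈ =
  [ larger-pair-after x<a x<c a≢c , larger-pair-after x<c x<a (a≢c ∘ sym) ] (before-or-after _ a∈ c∈ a≢c)

∈-tail : ∀ {v x : ℕ} {ys} → v ∈ x ∷ ys → v ≢ x → v ∈ ys
∈-tail (here v≡x) v≢x = ⊥-elim (v≢x v≡x)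
∈-tail (there v∈) _   = v∈

RunThenTop : (ℕ → ℕ → List ℕ → Set) → ℕ → ℕ → List ℕ → Set
RunThenTop P k M xs = Σ[ r ∈ ℕ ] Σ[ b ∈ ℕ ] Σ[ ρ ∈ List ℕ ] r + b ≡ k × xs ≡ run r b ++ M ∷ ρ × P r b ρ

-- Every entry is followed by at most one larger entry, so the entries before the
-- maximum M are k-1, k-2, ... in this order.
run-then-top : ∀ k M xs → k ≤ M → Unique xs → (∀ v → v ∈ xs ⇔ (v < k ⊎ v ≡ M)) →
               AvoidsAll p132-p123 xs → RunThenTop (λ _ b ρ → PermutationOf b ρ) k M xs
run-then-top k M [] k≤M u mem av with () ← from (mem M) (inj₂ refl)
run-then-top k M (x ∷ ys) k≤M (x∉ys ∷ u) mem av with to (mem x) (here refl)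
... | inj₂ refl = 0 , k , ys , refl , refl , u , λ v →
  mk⇔ (below v) (λ v<k → ∈-tail (from (mem v) (inj₁ v<k)) (λ { refl → <⇒≱ v<k k≤M }))
  where
  below : ∀ v → v ∈ ys → v < k
  below v v∈ with to (mem v) (there v∈)
  ... | inj₁ v<k  = v<k
  ... | inj₂ refl = ⊥-elim (All.lookup x∉ys v∈ refl)
run-then-top (suc k) M (x ∷ ys) k<M (x∉ys ∷ u) mem av | inj₁ x<1+k with x ≟ k
... | no x≢k = ⊥-elim (two-larger-after x<k (<-≤-trans x<1+k k<M) (<⇒≢ k<M) k∈ys M∈ys av)
  where
  x<k = ≤∧≢⇒< (≤-pred x<1+k) x≢k
  k∈ys = ∈-tail (from (mem k) (inj₁ (n<1+n k))) (x≢k ∘ sym)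
  M∈ys = ∈-tail (from (mem M) (inj₂ refl)) (<⇒≢ (<-≤-trans x<1+k k<M) ∘ sym)
... | yes refl =
  let (r , b , ρ , e , ys≡ , perm) = run-then-top x M ys (<⇒≤ k<M) u mem′ (avoids-suffix (x ∷ []) av)
  in suc r , b , ρ , cong suc e , cong₂ _∷_ (sym e) ys≡ , perm
  where
  mem′ : ∀ v → v ∈ ys ⇔ (v < x ⊎ v ≡ M)
  mem′ v = mk⇔
    (λ v∈ → [ (λ v<1+x → inj₁ (≤∧≢⇒< (≤-pred v<1+x) (All.lookup x∉ys v∈ ∘ sym))) , inj₂ ]
              (to (mem v) (there v∈)))
    (λ { (inj₁ v<x) → ∈-tail (from (mem v) (inj₁ (m<n⇒m<1+n v<x))) (<⇒≢ v<x)
       ; (inj₂ refl) → ∈-tail (from (mem M) (inj₂ refl)) (<⇒≢ k<M ∘ sym) })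

FirstBlock : (ℕ → ℕ → List ℕ → Set) → ℕ → List ℕ → Set
FirstBlock P k xs = Σ[ r ∈ ℕ ] Σ[ b ∈ ℕ ] Σ[ ρ ∈ List ℕ ] r + b ≡ k × xs ≡ block r b ++ ρ × P r b ρ

run-top-++ : ∀ {r b k} ρ → r + b ≡ k → run r b ++ k ∷ ρ ≡ block r b ++ ρ
run-top-++ {r} {b} ρ refl = sym (++-assoc (run r b) (r + b ∷ []) ρ)

avoiding-permutation⇒firstBlock : ∀ {k xs} → PermutationOf (suc k) xs → AvoidsAll p132-p123 xs →
                                  FirstBlock (λ _ b ρ → PermutationOf b ρ) k xs
avoiding-permutation⇒firstBlock {k} {xs} (u , mem) av =
  let (r , b , ρ , e , xs≡ , perm) = run-then-top k k xs ≤-refl u mem′ av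
  in r , b , ρ , e , trans xs≡ (run-top-++ ρ e) , perm
  where
  mem′ : ∀ v → v ∈ xs ⇔ (v < k ⊎ v ≡ k)
  mem′ v = mk⇔ (m<1+n⇒m<n∨m≡n ∘ to (mem v)) (from (mem v) ∘ [ m<n⇒m<1+n , (λ { refl → n<1+n k }) ])

block-++-permutation : ∀ r b {ρ} → PermutationOf b ρ → PermutationOf (suc (r + b)) (block r b ++ ρ)
block-++-permutation r b {ρ} (u , mem) =
  Unique.++⁺ (block-unique r b) u (λ (v∈B , v∈ρ) → <⇒≱ (to (mem _) v∈ρ) (proj₁ (∈-block⁻ r b v∈B))) ,
  λ v → mk⇔ (below v) (inside v)
  where
  below : ∀ v → v ∈ block r b ++ ρ → v < suc (r + b)
  below v v∈ with ∈-++⁻ (block r b) v∈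
  ... | inj₁ v∈B = s≤s (proj₂ (∈-block⁻ r b v∈B))
  ... | inj₂ v∈ρ = m<n⇒m<1+n (<-≤-trans (to (mem v) v∈ρ) (m≤n+m b r))
  inside : ∀ v → v < suc (r + b) → v ∈ block r b ++ ρ
  inside v v≤ with v <? b
  ... | yes v<b = ∈-++⁺ʳ (block r b) (from (mem v) v<b)
  ... | no  v≮b = ∈-++⁺ˡ (∈-block⁺ r b (≮⇒≥ v≮b) (≤-pred v≤))

Good : State → ℕ → List ℕ → Set
Good q n xs = PermutationOf n xs × AvoidsAll p132-p123 xs × AvoidsAll (forbidden q) xs

good-suc : ∀ q k xs → Good q (suc k) xs ⇔ FirstBlock (λ r b ρ → Good (next q (size r)) b ρ) k xs
good-suc q k xs = mk⇔ split join
  where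
  split : Good q (suc k) xs → FirstBlock (λ r b ρ → Good (next q (size r)) b ρ) k xs
  split (perm , av , avq) with avoiding-permutation⇒firstBlock perm av
  ... | r , b , ρ , e , refl , permρ@(_ , memρ) =
    r , b , ρ , e , refl , permρ , to avoids-p132-p123 av , to (avoids-next q (size r) (block-sizeFacts r b)) avq
    where open BlockAbove {r} (All.tabulate (to (memρ _)))
  join : FirstBlock (λ r b ρ → Good (next q (size r)) b ρ) k xs → Good q (suc k) xs
  join (r , b , ρ , refl , refl , permρ@(_ , memρ) , avρ , avqρ) =
    block-++-permutation r b permρ , from avoids-p132-p123 avρ ,
    from (avoids-next q (size r) (block-sizeFacts r b)) avqρ
    where open BlockAbove {r} (All.tabulate (to (memρ _)))

atEnd : State → List (List ℕ)
atEnd dead = []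
atEnd _    = [] ∷ []

-- The entries are produced one at a time so that the recursion is structural:
-- withTop f k M continues a block with maximum M, either closing it with M or
-- extending its run by k - 1; f r is the state reached after a run of length r.
perms     : State → ℕ → List (List ℕ)
withTop   : (ℕ → State) → ℕ → ℕ → List (List ℕ)
extendRun : (ℕ → State) → ℕ → ℕ → List (List ℕ)

perms q zero    = atEnd q
perms q (suc k) = withTop (next q ∘ size) k k

withTop f k M = map (M ∷_) (perms (f 0) k) ++ extendRun f k M

extendRun f zero    M = []
extendRun f (suc k) M = map (k ∷_) (withTop (f ∘ suc) k M)

∈-withTop : ∀ f k M xs → xs ∈ withTop f k M ⇔ RunThenTop (λ r b ρ → ρ ∈ perms (f r) b) k M xs
∈-withTop f k M xs = mk⇔ (split k xs) join
  where
  split : ∀ {f} k xs → xs ∈ withTop f k M → RunThenTop (λ r b ρ → ρ ∈ perms (f r) b) k M xs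
  split {f} k xs xs∈ with ∈-++⁻ (map (M ∷_) (perms (f 0) k)) xs∈
  ... | inj₁ xs∈top with ρ , ρ∈ , refl ← ∈-map⁻ (M ∷_) xs∈top = 0 , k , ρ , refl , refl , ρ∈
  split {f} (suc k) xs xs∈ | inj₂ xs∈ext with ys , ys∈ , refl ← ∈-map⁻ (k ∷_) xs∈ext
    with r , b , ρ , refl , refl , ρ∈ ← split {f ∘ suc} k ys ys∈ = suc r , b , ρ , refl , refl , ρ∈
  join : ∀ {f k xs} → RunThenTop (λ r b ρ → ρ ∈ perms (f r) b) k M xs → xs ∈ withTop f k M
  join (zero , b , ρ , refl , refl , ρ∈) = ∈-++⁺ˡ (∈-map⁺ (M ∷_) ρ∈)
  join {f} (suc r , b , ρ , refl , refl , ρ∈) =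
    ∈-++⁺ʳ (map (M ∷_) (perms (f 0) (suc r + b)))
      (∈-map⁺ (r + b ∷_) (join {f ∘ suc} (r , b , ρ , refl , refl , ρ∈)))

∈-perms-suc : ∀ q k xs → xs ∈ perms q (suc k) ⇔ FirstBlock (λ r b ρ → ρ ∈ perms (next q (size r)) b) k xs
∈-perms-suc q k xs = mk⇔
  (λ xs∈ → let (r , b , ρ , e , xs≡ , ρ∈) = to (∈-withTop _ k k xs) xs∈
           in r , b , ρ , e , trans xs≡ (run-top-++ ρ e) , ρ∈)
  (λ (r , b , ρ , e , xs≡ , ρ∈) →
    from (∈-withTop _ k k xs) (r , b , ρ , e , trans xs≡ (sym (run-top-++ ρ e)) , ρ∈))

firstBlock-cong : ∀ {P Q k xs} → (∀ {r b ρ} → r + b ≡ k → P r b ρ ⇔ Q r b ρ) →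
                  FirstBlock P k xs ⇔ FirstBlock Q k xs
firstBlock-cong P⇔Q = mk⇔
  (λ (r , b , ρ , e , xs≡ , p) → r , b , ρ , e , xs≡ , to (P⇔Q e) p)
  (λ (r , b , ρ , e , xs≡ , q) → r , b , ρ , e , xs≡ , from (P⇔Q e) q)

∈-atEnd : ∀ q xs → xs ∈ atEnd q ⇔ Good q 0 xs
∈-atEnd q xs = mk⇔ (good q) (member q)
  where
  perm₀ : PermutationOf 0 []
  perm₀ = [] , λ v → mk⇔ (λ ()) (λ ())
  good : ∀ q {xs} → xs ∈ atEnd q → Good q 0 xs
  good start     (here refl) = perm₀ , (λ ()) ∷ (λ ()) ∷ [] , (λ ()) ∷ []
  good middle    (here refl) = perm₀ , (λ ()) ∷ (λ ()) ∷ [] , (λ ()) ∷ (λ ()) ∷ []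
  good afterLong (here refl) = perm₀ , (λ ()) ∷ (λ ()) ∷ [] , (λ ()) ∷ (λ ()) ∷ (λ ()) ∷ []
  good finished  (here refl) = perm₀ , (λ ()) ∷ (λ ()) ∷ [] , (λ ()) ∷ (λ ()) ∷ (λ ()) ∷ (λ ()) ∷ []
  member : ∀ q {xs} → Good q 0 xs → xs ∈ atEnd q
  member q {x ∷ xs} ((_ , mem) , _) with () ← to (mem x) (here refl)
  member dead      {[]} (_ , _ , av) = ⊥-elim (nothing-avoids-dead av)
  member start     {[]} _ = here refl
  member middle    {[]} _ = here refl
  member afterLong {[]} _ = here refl
  member finished  {[]} _ = here refl

perms-correct : ∀ n q xs → xs ∈ perms q n ⇔ Good q n xs
perms-correct = <-rec (λ n → ∀ q xs → xs ∈ perms q n ⇔ Good q n xs) step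
  where
  step : ∀ n → (∀ {b} → b < n → ∀ q ρ → ρ ∈ perms q b ⇔ Good q b ρ) →
         ∀ q xs → xs ∈ perms q n ⇔ Good q n xs
  step zero    _  q xs = ∈-atEnd q xs
  step (suc k) ih q xs =
    ⇔.trans (∈-perms-suc q k xs)
   (⇔.trans (firstBlock-cong (λ {r} {b} {ρ} e → ih (s≤s (subst (b ≤_) e (m≤n+m b r))) (next q (size r)) ρ))
            (⇔.sym (good-suc q k xs)))

perms-unique     : ∀ q n → Unique (perms q n)
withTop-unique   : ∀ f k M → k ≤ M → Unique (withTop f k M)
extendRun-unique : ∀ f k M → k ≤ M → Unique (extendRun f k M)

perms-unique dead      zero    = []
perms-unique start     zero    = [] ∷ []
perms-unique middle    zero    = [] ∷ []
perms-unique afterLong zero    = [] ∷ []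
perms-unique finished  zero    = [] ∷ []
perms-unique q         (suc k) = withTop-unique _ k k ≤-refl

withTop-unique f k M k≤M =
  Unique.++⁺ (Unique.map⁺ ∷-injectiveʳ (perms-unique (f 0) k)) (extendRun-unique f k M k≤M) (distinct-heads k≤M)
  where
  distinct-heads : ∀ {k xs} → k ≤ M → ¬ (xs ∈ map (M ∷_) (perms (f 0) k) × xs ∈ extendRun f k M)
  distinct-heads {suc k′} k′<M (xs∈top , xs∈ext)
    with _ , _ , refl ← ∈-map⁻ (M ∷_) xs∈top | _ , _ , M≡k′ ← ∈-map⁻ (k′ ∷_) xs∈ext =
      <⇒≢ k′<M (sym (∷-injectiveˡ M≡k′))

extendRun-unique f zero    M _   = []
extendRun-unique f (suc k) M k<M = Unique.map⁺ ∷-injectiveʳ (withTop-unique (f ∘ suc) k M (<⇒≤ k<M))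

-- perms with lists replaced by their lengths, so that counts compute
count          : State → ℕ → ℕ
countWithTop   : (ℕ → State) → ℕ → ℕ
countExtendRun : (ℕ → State) → ℕ → ℕ

count q zero    = length (atEnd q)
count q (suc k) = countWithTop (next q ∘ size) k

countWithTop f k = count (f 0) k + countExtendRun f k

countExtendRun f zero    = 0
countExtendRun f (suc k) = countWithTop (f ∘ suc) k

length-perms     : ∀ q n → length (perms q n) ≡ count q n
length-withTop   : ∀ f k M → length (withTop f k M) ≡ countWithTop f k
length-extendRun : ∀ f k M → length (extendRun f k M) ≡ countExtendRun f k

length-perms q zero    = refl
length-perms q (suc k) = length-withTop _ k k

length-withTop f k M = begin
  length (map (M ∷_) (perms (f 0) k) ++ extendRun f k M)
    ≡⟨ length-++ (map (M ∷_) (perms (f 0) k)) ⟩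
  length (map (M ∷_) (perms (f 0) k)) + length (extendRun f k M)
    ≡⟨ cong₂ _+_ (trans (length-map _ (perms (f 0) k)) (length-perms (f 0) k)) (length-extendRun f k M) ⟩
  count (f 0) k + countExtendRun f k ∎
  where open ≡-Reasoning

length-extendRun f zero    M = refl
length-extendRun f (suc k) M = trans (length-map _ (withTop (f ∘ suc) k M)) (length-withTop (f ∘ suc) k M)

perms-length     : ∀ q n {xs} → xs ∈ perms q n → length xs ≡ n
withTop-length   : ∀ f k M {xs} → xs ∈ withTop f k M → length xs ≡ suc k
extendRun-length : ∀ f k M {xs} → xs ∈ extendRun f k M → length xs ≡ suc k

perms-length q zero    {[]}    _   = refl
perms-length q zero    {x ∷ _} x∈ with () ← to (proj₂ (proj₁ (to (∈-atEnd q _) x∈)) x) (here refl)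
perms-length q (suc k) xs∈ = withTop-length _ k k xs∈

withTop-length f k M xs∈ with ∈-++⁻ (map (M ∷_) (perms (f 0) k)) xs∈
... | inj₁ xs∈top with _ , ρ∈ , refl ← ∈-map⁻ (M ∷_) xs∈top = cong suc (perms-length (f 0) k ρ∈)
... | inj₂ xs∈ext = extendRun-length f k M xs∈ext

extendRun-length f (suc k) M xs∈ with _ , ys∈ , refl ← ∈-map⁻ (k ∷_) xs∈ =
  cong suc (withTop-length (f ∘ suc) k M ys∈)

-- by definition, countWithTop (λ _ → q) k = count q k + count q (k - 1) + … + count q 0
prefix-dead : ∀ k → countWithTop (λ _ → dead) k ≡ 0
prefix-dead zero    = refl
prefix-dead (suc k) = cong₂ _+_ (prefix-dead k) (prefix-dead k)

afterLong-empty : ∀ m → count afterLong (3 + m) ≡ 0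
afterLong-empty m = cong₂ _+_ (prefix-dead (suc m)) (cong₂ _+_ (prefix-dead m) (prefix-dead m))

-- after a long block at most one block of size ≤ 2 may follow: count afterLong = 1, 1, 1, 0, 0, …
afterLong-prefix : ∀ m → countWithTop (λ _ → afterLong) (2 + m) ≡ 3
afterLong-prefix zero    = refl
afterLong-prefix (suc m) = cong₂ _+_ (afterLong-empty m) (afterLong-prefix m)

count-middle-rec : ∀ m → count middle (5 + m) ≡ count middle (4 + m) + (count middle (3 + m) + 3)
count-middle-rec m = cong (λ w → count middle (4 + m) + (count middle (3 + m) + w)) (afterLong-prefix m)

fibonacci-like-unique : ∀ (u v : ℕ → ℕ) →
                        (∀ n → u (2 + n) ≡ u (1 + n) + u n) → (∀ n → v (2 + n) ≡ v (1 + n) + v n) →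
                        u 0 ≡ v 0 → u 1 ≡ v 1 → ∀ n → u n ≡ v n
fibonacci-like-unique u v u-rec v-rec u₀ u₁ n = proj₁ (consecutive n)
  where
  consecutive : ∀ n → u n ≡ v n × u (1 + n) ≡ v (1 + n)
  consecutive zero    = u₀ , u₁
  consecutive (suc n) =
    let (uₙ , uₙ₊₁) = consecutive n in uₙ₊₁ , trans (u-rec n) (trans (cong₂ _+_ uₙ₊₁ uₙ) (sym (v-rec n)))

-- the paper's F (n + 3) + F (n + 1), i.e. the Lucas number L (n + 2)
lucas₂ : ℕ → ℕ
lucas₂ n = F (n + 3) + F (n + 1)

lucas₂-rec : ∀ n → lucas₂ (2 + n) ≡ lucas₂ (1 + n) + lucas₂ n
lucas₂-rec n = solve 4 (λ a b c d → (a :+ b) :+ (c :+ d) := (a :+ c) :+ (b :+ d)) refl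
  (F (suc (n + 3))) (F (n + 3)) (F (suc (n + 1))) (F (n + 1))
  where open Data.Nat.Solver.+-*-Solver

count-middle-closed : ∀ m → count middle (3 + m) + 3 ≡ lucas₂ (2 + m)
count-middle-closed = fibonacci-like-unique (λ m → count middle (3 + m) + 3) (λ m → lucas₂ (2 + m))
  shifted-rec (λ m → lucas₂-rec (2 + m)) refl refl
  where
  open Data.Nat.Solver.+-*-Solver
  shifted-rec : ∀ m → count middle (5 + m) + 3 ≡ (count middle (4 + m) + 3) + (count middle (3 + m) + 3)
  shifted-rec m = trans (cong (_+ 3) (count-middle-rec m))
    (solve 2 (λ h₄ h₃ → h₄ :+ (h₃ :+ con 3) :+ con 3 := (h₄ :+ con 3) :+ (h₃ :+ con 3)) refl
      (count middle (4 + m)) (count middle (3 + m)))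

count-start-closed : ∀ m → count start (3 + m) + 3 * (3 + m) ≡ lucas₂ (3 + m) + 2
count-start-closed zero    = refl
count-start-closed (suc m) = begin
  count start (4 + m) + 3 * (4 + m)
    ≡⟨ solve 3 (λ h g m → (h :+ g) :+ con 3 :* (con 4 :+ m) := (h :+ con 3) :+ (g :+ con 3 :* (con 3 :+ m)))
         refl (count middle (3 + m)) (count start (3 + m)) m ⟩
  (count middle (3 + m) + 3) + (count start (3 + m) + 3 * (3 + m))
    ≡⟨ cong₂ _+_ (count-middle-closed m) (count-start-closed m) ⟩
  lucas₂ (2 + m) + (lucas₂ (3 + m) + 2)
    ≡⟨ solve 2 (λ l₂ l₃ → l₂ :+ (l₃ :+ con 2) := (l₃ :+ l₂) :+ con 2) refl
         (lucas₂ (2 + m)) (lucas₂ (3 + m)) ⟩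
  (lucas₂ (3 + m) + lucas₂ (2 + m)) + 2
    ≡⟨ cong (_+ 2) (sym (lucas₂-rec (2 + m))) ⟩
  lucas₂ (4 + m) + 2 ∎
  where
  open ≡-Reasoning
  open Data.Nat.Solver.+-*-Solver

count-formula : ∀ n → 3 ≤ n → + count start n ≡ ((+ F (n + 3) +ℤ + F (n + 1)) -ℤ + (3 * n)) +ℤ + 2
count-formula n 3≤n with m , refl ← m≤n⇒∃[o]m+o≡n 3≤n = begin
  + count start n
    ≡⟨ solve 2 (λ a c → a := (a :+ c) :- c) refl (+ count start n) (+ (3 * n)) ⟩
  + (count start n + 3 * n) -ℤ + (3 * n)
    ≡⟨ cong (λ z → + z -ℤ + (3 * n)) (count-start-closed m) ⟩
  + (lucas₂ n + 2) -ℤ + (3 * n)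
    ≡⟨ solve 3 (λ x y c → x :+ y :+ con (+ 2) :- c := x :+ y :- c :+ con (+ 2)) refl
         (+ F (n + 3)) (+ F (n + 1)) (+ (3 * n)) ⟩
  ((+ F (n + 3) +ℤ + F (n + 1)) -ℤ + (3 * n)) +ℤ + 2 ∎
  where
  open ≡-Reasoning
  open Data.Integer.Solver.+-*-Solver

middle-second-difference : ∀ m →
  count middle (6 + m) + count middle (3 + m) ≡ count middle (5 + m) + count middle (5 + m)
middle-second-difference m = begin
  count middle (6 + m) + count middle (3 + m)
    ≡⟨ cong (_+ count middle (3 + m)) (count-middle-rec (suc m)) ⟩
  count middle (5 + m) + (count middle (4 + m) + 3) + count middle (3 + m)
    ≡⟨ solve 3 (λ h₅ h₄ h₃ → h₅ :+ (h₄ :+ con 3) :+ h₃ := h₅ :+ (h₄ :+ (h₃ :+ con 3))) refl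
         (count middle (5 + m)) (count middle (4 + m)) (count middle (3 + m)) ⟩
  count middle (5 + m) + (count middle (4 + m) + (count middle (3 + m) + 3))
    ≡⟨ cong (λ z → count middle (5 + m) + z) (sym (count-middle-rec m)) ⟩
  count middle (5 + m) + count middle (5 + m) ∎
  where
  open ≡-Reasoning
  open Data.Nat.Solver.+-*-Solver

-- a (n + 1) = a n + count middle n, so the identity reduces to the one above.
-- It is written without multiplication so that it transfers to ℤ definitionally.
count-start-annihilated : ∀ m →
  count start (7 + m) + count start (5 + m) + count start (5 + m) + count start (4 + m) ≡
  count start (6 + m) + count start (6 + m) + count start (6 + m) + count start (3 + m)
count-start-annihilated m = begin
  (h₆ + (h₅ + a₅)) + a₅ + a₅ + (h₃ + a₃)
    ≡⟨ solve 5 (λ h₆ h₅ h₃ a₅ a₃ → (h₆ :+ (h₅ :+ a₅)) :+ a₅ :+ a₅ :+ (h₃ :+ a₃)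
                                 := (h₆ :+ h₃) :+ (h₅ :+ a₅ :+ a₅ :+ a₅ :+ a₃)) refl h₆ h₅ h₃ a₅ a₃ ⟩
  (h₆ + h₃) + (h₅ + a₅ + a₅ + a₅ + a₃)
    ≡⟨ cong (_+ (h₅ + a₅ + a₅ + a₅ + a₃)) (middle-second-difference m) ⟩
  (h₅ + h₅) + (h₅ + a₅ + a₅ + a₅ + a₃)
    ≡⟨ solve 3 (λ h₅ a₅ a₃ → (h₅ :+ h₅) :+ (h₅ :+ a₅ :+ a₅ :+ a₅ :+ a₃)
                           := (h₅ :+ a₅) :+ (h₅ :+ a₅) :+ (h₅ :+ a₅) :+ a₃) refl h₅ a₅ a₃ ⟩
  (h₅ + a₅) + (h₅ + a₅) + (h₅ + a₅) + a₃ ∎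
  where
  open ≡-Reasoning
  open Data.Nat.Solver.+-*-Solver
  h₆ = count middle (6 + m)
  h₅ = count middle (5 + m)
  h₃ = count middle (3 + m)
  a₅ = count start (5 + m)
  a₃ = count start (3 + m)

sumUpTo : (ℕ → ℤ) → ℕ → ℤ
sumUpTo h n = foldr _+ℤ_ (+ 0) (map h (upTo n))

sumUpTo-suc : ∀ h n → sumUpTo h (suc n) ≡ h 0 +ℤ sumUpTo (h ∘ suc) n
sumUpTo-suc h n = cong (λ hs → h 0 +ℤ foldr _+ℤ_ (+ 0) hs)
  (trans (map-applyUpTo suc h n) (sym (map-applyUpTo (λ k → k) (h ∘ suc) n)))

sumUpTo-zeros : ∀ n → sumUpTo (λ _ → + 0) n ≡ + 0
sumUpTo-zeros zero    = refl
sumUpTo-zeros (suc n) = trans (sumUpTo-suc (λ _ → + 0) n) (trans (+-identityˡ _) (sumUpTo-zeros n))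

-- combination cs g n = Σ_{i ≤ n} cᵢ · g (n - i), in the shape (trailing + 0 included)
-- in which poly cs ⊛ g unfolds
combination : List ℤ → Series → ℕ → ℤ
combination []       g n       = + 0
combination (c ∷ cs) g zero    = c ℤ.* g zero +ℤ + 0
combination (c ∷ cs) g (suc n) = c ℤ.* g (suc n) +ℤ combination cs g n

poly-⊛ : ∀ cs g n → (poly cs ⊛ g) n ≡ combination cs g n
poly-⊛ []       g n       = sumUpTo-zeros (suc n)
poly-⊛ (c ∷ cs) g zero    = refl
poly-⊛ (c ∷ cs) g (suc n) =
  trans (sumUpTo-suc (λ k → poly (c ∷ cs) k ℤ.* g (suc n ∸ k)) (suc n))
        (cong (c ℤ.* g (suc n) +ℤ_) (poly-⊛ cs g n))

⊛-congˡ : ∀ {f f′} g → (∀ k → f k ≡ f′ k) → ∀ n → (f ⊛ g) n ≡ (f′ ⊛ g) n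
⊛-congˡ g f≗f′ n = cong (foldr _+ℤ_ (+ 0)) (map-cong (λ k → cong (ℤ._* g (n ∸ k)) (f≗f′ k)) (upTo (suc n)))

-- (1 - x)² (1 - x - x²) = 1 - 3x + 2x² + x³ - x⁴
denominator : List ℤ
denominator = + 1 ∷ -[1+ 2 ] ∷ + 2 ∷ + 1 ∷ -[1+ 0 ] ∷ []

denominator-⊛ : ∀ n → ((oneMinusX ⊛ oneMinusX) ⊛ oneMinusXMinusX²) n ≡ poly denominator n
denominator-⊛ n =
  trans (⊛-congˡ oneMinusXMinusX² square n)
        (trans (poly-⊛ (+ 1 ∷ -[1+ 1 ] ∷ + 1 ∷ []) oneMinusXMinusX² n) (product n))
  where
  square : ∀ n → (oneMinusX ⊛ oneMinusX) n ≡ poly (+ 1 ∷ -[1+ 1 ] ∷ + 1 ∷ []) n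
  square n = trans (poly-⊛ (+ 1 ∷ -[1+ 0 ] ∷ []) oneMinusX n) (expand n)
    where
    expand : ∀ n → combination (+ 1 ∷ -[1+ 0 ] ∷ []) oneMinusX n ≡ poly (+ 1 ∷ -[1+ 1 ] ∷ + 1 ∷ []) n
    expand 0 = refl
    expand 1 = refl
    expand 2 = refl
    expand (suc (suc (suc n))) = refl
  product : ∀ n → combination (+ 1 ∷ -[1+ 1 ] ∷ + 1 ∷ []) oneMinusXMinusX² n ≡ poly denominator n
  product 0 = refl
  product 1 = refl
  product 2 = refl
  product 3 = refl
  product 4 = refl
  product (suc (suc (suc (suc (suc n))))) = refl

denominator-annihilates : ∀ (u : ℕ → ℕ) → u 4 + u 2 + u 2 + u 1 ≡ u 3 + u 3 + u 3 + u 0 →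
                          combination denominator (λ k → + u k +ℤ + 0) 4 ≡ + 0
denominator-annihilates u e = begin
  combination denominator (λ k → + u k +ℤ + 0) 4
    ≡⟨ solve 5 (λ u₀ u₁ u₂ u₃ u₄ →
         con (+ 1) :* (u₄ :+ con (+ 0)) :+ (con -[1+ 2 ] :* (u₃ :+ con (+ 0)) :+ (con (+ 2) :* (u₂ :+ con (+ 0)) :+
           (con (+ 1) :* (u₁ :+ con (+ 0)) :+ (con -[1+ 0 ] :* (u₀ :+ con (+ 0)) :+ con (+ 0)))))
         := (u₄ :+ u₂ :+ u₂ :+ u₁) :- (u₃ :+ u₃ :+ u₃ :+ u₀))
         refl (+ u 0) (+ u 1) (+ u 2) (+ u 3) (+ u 4) ⟩
  + (u 4 + u 2 + u 2 + u 1) -ℤ + (u 3 + u 3 + u 3 + u 0)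
    ≡⟨ cong (λ z → + z -ℤ + (u 3 + u 3 + u 3 + u 0)) e ⟩
  + (u 3 + u 3 + u 3 + u 0) -ℤ + (u 3 + u 3 + u 3 + u 0)
    ≡⟨ +-inverseʳ (+ (u 3 + u 3 + u 3 + u 0)) ⟩
  + 0 ∎
  where
  open ≡-Reasoning
  open Data.Integer.Solver.+-*-Solver

generating-function : ∀ n →
  (((oneMinusX ⊛ oneMinusX) ⊛ oneMinusXMinusX²) ⊛ (genSeries (count start) ⊕ fourPlus2xPlusX²)) n ≡ numerator n
generating-function n =
  trans (⊛-congˡ series denominator-⊛ n) (trans (poly-⊛ denominator series n) (coefficient n))
  where
  series = genSeries (count start) ⊕ fourPlus2xPlusX²
  coefficient : ∀ n → combination denominator series n ≡ numerator n
  coefficient 0 = refl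
  coefficient 1 = refl
  coefficient 2 = refl
  coefficient 3 = refl
  coefficient 4 = refl
  coefficient 5 = refl
  coefficient 6 = refl
  coefficient (suc (suc (suc (suc (suc (suc (suc m))))))) =
    denominator-annihilates (λ k → count start (k + (3 + m))) (count-start-annihilated m)

inAv⇔good : ∀ n (π : Word n) → InAv n π ⇔ Good start n (values π)
inAv⇔good n π = mk⇔
  (λ (perm , ¬132 , ¬123 , ¬γ) →
    to (isPerm⇔permutationOf π) perm ,
    (¬132 ∘ from (contains⇔occurs π p132) ∷ ¬123 ∘ from (contains⇔occurs π p123) ∷ []) ,
    (¬γ ∘ from (contains⇔occurs π γ122) ∷ []))
  (λ { (perm , (¬132 ∷ ¬123 ∷ []) , (¬γ ∷ [])) →
    from (isPerm⇔permutationOf π) perm ,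
    ¬132 ∘ to (contains⇔occurs π p132) , ¬123 ∘ to (contains⇔occurs π p123) ,
    ¬γ ∘ to (contains⇔occurs π γ122) })

hasCard : ∀ n → HasCard (InAv n) (count start n)
hasCard n = map (toWord n) (perms start n) , unique , (λ π → mk⇔ (member⇒inAv π) (inAv⇒member π)) ,
            trans (length-map (toWord n) (perms start n)) (length-perms start n)
  where
  round-trip : ∀ {xs} → xs ∈ perms start n → values (toWord n xs) ≡ xs
  round-trip xs∈ = values-toWord n _ (perms-length start n xs∈)
    (All.tabulate (λ v∈ → to (proj₂ (proj₁ (to (perms-correct n start _) xs∈)) _) v∈))
  unique : Unique (map (toWord n) (perms start n))
  unique = Unique.map⁻ {f = values}
    (subst Unique (sym (trans (sym (map-∘ (perms start n))) (map-id-local (All.tabulate round-trip))))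
      (perms-unique start n))
  member⇒inAv : ∀ π → π ∈ map (toWord n) (perms start n) → InAv n π
  member⇒inAv π π∈ with xs , xs∈ , refl ← ∈-map⁻ (toWord n) π∈ =
    from (inAv⇔good n (toWord n xs)) (subst (Good start n) (sym (round-trip xs∈)) (to (perms-correct n start xs) xs∈))
  inAv⇒member : ∀ π → InAv n π → π ∈ map (toWord n) (perms start n)
  inAv⇒member π inAv = subst (_∈ map (toWord n) (perms start n)) (toWord-values n π)
    (∈-map⁺ (toWord n) (from (perms-correct n start (values π)) (to (inAv⇔good n π) inAv)))

mainTheorem11 : Σ (ℕ → ℕ) λ a →
    ((n : ℕ) → HasCard (InAv n) (a n)) ×
    ((n : ℕ) → 3 ≤ n →
      + (a n) ≡ ((+ F (n + 3) +ℤ + F (n + 1)) -ℤ + (3 * n)) +ℤ + 2) ×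
    ((n : ℕ) →
      (((oneMinusX ⊛ oneMinusX) ⊛ oneMinusXMinusX²) ⊛ (genSeries a ⊕ fourPlus2xPlusX²)) n
        ≡ numerator n)
mainTheorem11 = count start , hasCard , count-formula , generating-function
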